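{- Let $G$ be a connected simple graph on $n$ vertices with minimum degree $2$ which is critical (for minimum degree $2$). Then either \begin{enumerate} \item $G$ is a cycle, or \item $V(G)$ can be partitioned as $Y_1\cup Y_2$ with $2\le |Y_1|\le n-3$ such that: $G[Y_1]$ is a path; $G[Y_2]$ has minimum degree $2$; each of the two endvertices of the path $G[Y_1]$ has exactly one edge to $Y_2$; the endpoints in $Y_2$ of these two edges are either the same vertex or are non-adjacent; and there are no other edges between $Y_1$ and $Y_2$. \end{enumerate}
   Context: For a graph $G$ with minimum degree $\delta$: $G$ is edge-critical if for every edge $e$ the graph $G-e$ has minimum degree $\delta-1$; $G$ is vertex-critical if for every vertex $v$ the graph $G-v$ has minimum degree strictly smaller than $\delta$; $G$ is critical if it is both edge-critical and vertex-critical. $G[Y]$ denotes the subgraph induced by $Y$. -}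

module Defs where

open import Data.Nat using (ℕ; zero; suc; _+_; _∸_; _≤_; _<_)
open import Data.Fin using (Fin; toℕ; _≟_)
open import Data.Fin.Subset using (Subset; ⊤; ∁; _∩_; ∣_∣; _∈_; _∉_; ⁅_⁆)
open import Data.Bool using (Bool; true; false; _∧_; _∨_; not)
open import Data.Vec using (tabulate)
open import Data.Product using (Σ; ∃; _×_; _,_)
open import Data.Sum using (_⊎_)
open import Relation.Nullary using (¬_)
open import Relation.Nullary.Decidable using (⌊_⌋)
open import Relation.Binary.PropositionalEquality using (_≡_)
open import Data.Fin.Permutation using (Permutation′; _⟨$⟩ʳ_)

record SimpleGraph (n : ℕ) : Set where
  field
    adj    : Fin n → Fin n → Bool
    sym    : ∀ u v → adj u v ≡ adj v u
    irrefl : ∀ v → adj v v ≡ false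
open SimpleGraph public

Adjacency : ℕ → Set
Adjacency n = Fin n → Fin n → Bool

N : ∀ {n} → Adjacency n → Fin n → Subset n
N a v = tabulate (a v)

degIn : ∀ {n} → Adjacency n → Subset n → Fin n → ℕ
degIn a Y v = ∣ N a v ∩ Y ∣

HasMinDeg : ∀ {n} → Adjacency n → Subset n → ℕ → Set
HasMinDeg a Y k =
  (∀ v → v ∈ Y → k ≤ degIn a Y v) × (∃ λ v → v ∈ Y × degIn a Y v ≡ k)

deleteEdge : ∀ {n} → Adjacency n → Fin n → Fin n → Adjacency n
deleteEdge a u v x y =
  a x y ∧ not ((⌊ x ≟ u ⌋ ∧ ⌊ y ≟ v ⌋) ∨ (⌊ x ≟ v ⌋ ∧ ⌊ y ≟ u ⌋))

EdgeCritical : ∀ {n} → SimpleGraph n → ℕ → Set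
EdgeCritical G δ = ∀ u v → adj G u v ≡ true → HasMinDeg (deleteEdge (adj G) u v) ⊤ (δ ∸ 1)

VertexCritical : ∀ {n} → SimpleGraph n → ℕ → Set
VertexCritical G δ = ∀ v → ∃ λ k → k < δ × HasMinDeg (adj G) (∁ ⁅ v ⁆) k

Critical : ∀ {n} → SimpleGraph n → ℕ → Set
Critical G δ = EdgeCritical G δ × VertexCritical G δ

data Reach {n} (G : SimpleGraph n) : Fin n → Fin n → Set where
  here : ∀ {u} → Reach G u u
  step : ∀ {u w v} → adj G u w ≡ true → Reach G w v → Reach G u v

Connected : ∀ {n} → SimpleGraph n → Set
Connected {n} G = (u v : Fin n) → Reach G u v

CycleAdj : (n : ℕ) → Fin n → Fin n → Set
CycleAdj n i j =
  suc (toℕ i) ≡ toℕ j ⊎ suc (toℕ j) ≡ toℕ i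
  ⊎ (toℕ i ≡ 0 × suc (toℕ j) ≡ n) ⊎ (toℕ j ≡ 0 × suc (toℕ i) ≡ n)

PathAdj : (k : ℕ) → Fin k → Fin k → Set
PathAdj k i j = suc (toℕ i) ≡ toℕ j ⊎ suc (toℕ j) ≡ toℕ i

IsCycle : ∀ {n} → SimpleGraph n → Set
IsCycle {n} G = 3 ≤ n × Σ (Permutation′ n) λ σ → ∀ i j →
  (adj G (σ ⟨$⟩ʳ i) (σ ⟨$⟩ʳ j) ≡ true → CycleAdj n i j)
  × (CycleAdj n i j → adj G (σ ⟨$⟩ʳ i) (σ ⟨$⟩ʳ j) ≡ true)

InducedPath : ∀ {n} → SimpleGraph n → Subset n → (k : ℕ) → (Fin k → Fin n) → Set
InducedPath {n} G Y k p =
  (∀ i j → p i ≡ p j → i ≡ j)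
  × (∀ x → (x ∈ Y → ∃ λ i → p i ≡ x) × ((∃ λ i → p i ≡ x) → x ∈ Y))
  × (∀ i j → (adj G (p i) (p j) ≡ true → PathAdj k i j) × (PathAdj k i j → adj G (p i) (p j) ≡ true))

module Submission where

-- Criticality is used only through two local facts: every edge has an end of
-- degree 2 (edge-criticality) and every vertex has a neighbour of degree 2
-- (vertex-criticality).  The proof follows non-backtracking walks: in a graph of
-- minimum degree 2 a walk can always be continued without stepping back, and it is
-- forced through vertices of degree 2.
--   * If every vertex has degree 2, the walk from any vertex closes up, and by
--     connectivity it visits every vertex exactly once, so G is a cycle.
--   * Otherwise take h of degree ≠ 2 and walk away from it through degree-2
--     vertices.  If the walk stops at a vertex b of degree ≠ 2 after at least two
--     inner vertices, these form the hanging path Y₁; if it returns to h and h has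
--     degree ≥ 4, the same works.  Stopping earlier contradicts criticality.  If h
--     has degree 3, walks along two different edges cannot both return to h.

open import Defs hiding (sym)
open import Data.Bool using (Bool; true; false; _∧_; _∨_; not; if_then_else_)
open import Data.Bool.Properties using (∧-identityʳ; ∧-zeroʳ; ∨-zeroʳ)
open import Data.Empty using (⊥; ⊥-elim)
open import Data.Fin using (Fin; zero; suc; toℕ; fromℕ; fromℕ<; cast; _≟_)
import Data.Fin.Properties as FinP
open import Data.Fin.Permutation using (Permutation′; permutation)
open import Data.Fin.Subset using (Subset; ⊤; ∁; _∩_; ∣_∣; _∈_; _∉_; ⁅_⁆)
open import Data.Fin.Subset.Properties using (x≢y⇒x∉⁅y⁆)
open import Data.Nat using (ℕ; zero; suc; _+_; _∸_; _≤_; _<_; z≤n; s≤s; s≤s⁻¹)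
import Data.Nat as ℕ
open import Data.Nat.Properties
  using ( ≤-refl; ≤-reflexive; ≤-trans; ≤-antisym; <⇒≤; <⇒≢; <⇒≱; ≰⇒>
        ; m≤n⇒m≤1+n; n≤1+n; m≤n⇒m<n∨m≡n; +-monoʳ-≤; m≤m+n; m+[n∸m]≡n; +-suc; +-identityʳ; suc-injective)
open import Data.Product using (Σ; _×_; _,_; proj₁; proj₂; uncurry)
open import Data.Sum using (_⊎_; inj₁; inj₂; [_,_]; map₂)
open import Data.Vec using ([]; _∷_; tabulate; lookup)
open import Data.Vec.Properties using (lookup-map; lookup-replicate; lookup⇒[]=; []=⇒lookup; lookup∘tabulate)
open import Function using (_∘_)
open import Relation.Nullary using (¬_; Dec; does; yes; no)
open import Relation.Binary.PropositionalEquality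
  using (_≡_; _≢_; refl; trans; cong; subst; subst₂; module ≡-Reasoning) renaming (sym to ≡-sym)

∧-true⁻ : ∀ {p q} → p ∧ q ≡ true → p ≡ true × q ≡ true
∧-true⁻ {true} q≡true = refl , q≡true

count : ∀ {n} → (Fin n → Bool) → ℕ
count {zero}  f = 0
count {suc n} f = if f zero then suc (count (f ∘ suc)) else count (f ∘ suc)

count-ext : ∀ {n} (f g : Fin n → Bool) → (∀ x → f x ≡ g x) → count f ≡ count g
count-ext {zero}  f g f≗g = refl
count-ext {suc n} f g f≗g rewrite f≗g zero =
  cong (λ k → if g zero then suc k else k) (count-ext (f ∘ suc) (g ∘ suc) (f≗g ∘ suc))

count-mono : ∀ {n} (f g : Fin n → Bool) → (∀ x → f x ≡ true → g x ≡ true) → count f ≤ count g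
count-mono {zero}  f g f⊆g = z≤n
count-mono {suc n} f g f⊆g with f zero in f0 | g zero in g0
... | true  | true  = s≤s (count-mono (f ∘ suc) (g ∘ suc) (f⊆g ∘ suc))
... | true  | false with () ← trans (≡-sym (f⊆g zero f0)) g0
... | false | true  = m≤n⇒m≤1+n (count-mono (f ∘ suc) (g ∘ suc) (f⊆g ∘ suc))
... | false | false = count-mono (f ∘ suc) (g ∘ suc) (f⊆g ∘ suc)

count-mono-except : ∀ {n} (f g : Fin n → Bool) (z : Fin n) →
  (∀ x → x ≢ z → f x ≡ true → g x ≡ true) → count f ≤ suc (count g)
count-mono-except {zero} f g z f⊆g = z≤n
count-mono-except {suc n} f g zero f⊆g
  with f zero | g zero | count-mono (f ∘ suc) (g ∘ suc) (λ x → f⊆g (suc x) λ ())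
... | true  | true  | le = s≤s (m≤n⇒m≤1+n le)
... | true  | false | le = s≤s le
... | false | true  | le = m≤n⇒m≤1+n (m≤n⇒m≤1+n le)
... | false | false | le = m≤n⇒m≤1+n le
count-mono-except {suc n} f g (suc z) f⊆g
  with f zero in f0 | g zero in g0
     | count-mono-except (f ∘ suc) (g ∘ suc) z (λ x x≢z → f⊆g (suc x) (x≢z ∘ FinP.suc-injective))
... | true  | true  | le = s≤s le
... | true  | false | _ with () ← trans (≡-sym (f⊆g zero (λ ()) f0)) g0
... | false | true  | le = m≤n⇒m≤1+n le
... | false | false | le = le

remove : ∀ {n} → (Fin n → Bool) → Fin n → Fin n → Bool
remove f z x = f x ∧ not (does (x ≟ z))

remove-keeps : ∀ {n} (f : Fin n → Bool) z x → x ≢ z → f x ≡ true → remove f z x ≡ true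
remove-keeps f z x x≢z fx with x ≟ z
... | yes x≡z = ⊥-elim (x≢z x≡z)
... | no _    rewrite fx = refl

remove-sound : ∀ {n} (f : Fin n → Bool) z x → remove f z x ≡ true → f x ≡ true × x ≢ z
remove-sound f z x r with f x | x ≟ z
... | true | no x≢z = refl , x≢z

count-remove : ∀ {n} (f : Fin n → Bool) z → f z ≡ true → count f ≡ suc (count (remove f z))
count-remove f zero fz rewrite fz =
  cong suc (count-ext (f ∘ suc) (remove f zero ∘ suc) (λ x → ≡-sym (∧-identityʳ (f (suc x)))))
count-remove f (suc z) fz with f zero
... | true  = cong suc (count-remove (f ∘ suc) z fz)
... | false = count-remove (f ∘ suc) z fz

count-remove-≤ : ∀ {n} (f : Fin n → Bool) z → count f ≤ suc (count (remove f z))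
count-remove-≤ f z = count-mono-except f (remove f z) z (remove-keeps f z)

count-pos : ∀ {n} (f : Fin n → Bool) z → f z ≡ true → 1 ≤ count f
count-pos f z fz rewrite count-remove f z fz = s≤s z≤n

witness : ∀ {n} (f : Fin n → Bool) → 1 ≤ count f → Σ (Fin n) λ x → f x ≡ true
witness {suc n} f pos with f zero in f0
... | true  = zero , f0
... | false with witness (f ∘ suc) pos
...   | x , fx = suc x , fx

member-avoiding : ∀ {n} (f : Fin n → Bool) u → 2 ≤ count f → Σ (Fin n) λ w → f w ≡ true × w ≢ u
member-avoiding f u two with witness (remove f u) (s≤s⁻¹ (≤-trans two (count-remove-≤ f u)))
... | w , rw = w , remove-sound f u w rw

member-avoiding₂ : ∀ {n} (f : Fin n → Bool) u v → 3 ≤ count f →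
  Σ (Fin n) λ w → f w ≡ true × w ≢ u × w ≢ v
member-avoiding₂ f u v three
  with member-avoiding (remove f u) v
         (s≤s⁻¹ (≤-trans three (count-remove-≤ f u)))
... | w , rw , w≢v with remove-sound f u w rw
...   | fw , w≢u = w , fw , w≢u , w≢v

three-members : ∀ {n} (f : Fin n → Bool) u v w → f u ≡ true → f v ≡ true → f w ≡ true →
  u ≢ v → u ≢ w → v ≢ w → 3 ≤ count f
three-members f u v w fu fv fw u≢v u≢w v≢w
  rewrite count-remove f u fu | count-remove (remove f u) v (remove-keeps f u v (u≢v ∘ ≡-sym) fv) =
  s≤s (s≤s (count-pos (remove (remove f u) v) w
    (remove-keeps (remove f u) v w (v≢w ∘ ≡-sym) (remove-keeps f u w (u≢w ∘ ≡-sym) fw))))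

exactly-two : ∀ {n} (f : Fin n → Bool) u v z → count f ≡ 2 →
  f u ≡ true → f v ≡ true → u ≢ v → f z ≡ true → z ≡ u ⊎ z ≡ v
exactly-two f u v z two fu fv u≢v fz with z ≟ u | z ≟ v
... | yes z≡u | _       = inj₁ z≡u
... | no _    | yes z≡v = inj₂ z≡v
... | no z≢u  | no z≢v  =
  ⊥-elim (3≰2 (subst (3 ≤_) two (three-members f u v z fu fv fz u≢v (z≢u ∘ ≡-sym) (z≢v ∘ ≡-sym))))
  where
    3≰2 : ¬ 3 ≤ 2
    3≰2 (s≤s (s≤s ()))

exactly-three : ∀ {n} (f : Fin n → Bool) u v w z → count f ≡ 3 →
  f u ≡ true → f v ≡ true → f w ≡ true → u ≢ v → u ≢ w → v ≢ w →
  f z ≡ true → z ≡ u ⊎ z ≡ v ⊎ z ≡ w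
exactly-three f u v w z three fu fv fw u≢v u≢w v≢w fz with z ≟ w
... | yes z≡w = inj₂ (inj₂ z≡w)
... | no z≢w = map₂ inj₁
  (exactly-two (remove f w) u v z (suc-injective (trans (≡-sym (count-remove f w fw)) three))
    (remove-keeps f w u u≢w fu) (remove-keeps f w v v≢w fv) u≢v (remove-keeps f w z z≢w fz))

count-mono-except₂ : ∀ {n} (f g : Fin n → Bool) z₁ z₂ →
  (∀ x → x ≢ z₁ → x ≢ z₂ → f x ≡ true → g x ≡ true) → count f ≤ suc (suc (count g))
count-mono-except₂ f g z₁ z₂ f⊆g =
  ≤-trans (count-remove-≤ f z₁) (s≤s (count-mono-except (remove f z₁) g z₂ rest))
  where
    rest : ∀ x → x ≢ z₂ → remove f z₁ x ≡ true → g x ≡ true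
    rest x x≢z₂ rx with remove-sound f z₁ x rx
    ... | fx , x≢z₁ = f⊆g x x≢z₁ x≢z₂ fx

count-complement : ∀ {n} (f : Fin n → Bool) → count f + count (not ∘ f) ≡ n
count-complement {zero}  f = refl
count-complement {suc n} f with f zero
... | true  = cong suc (count-complement (f ∘ suc))
... | false = trans (+-suc (count (f ∘ suc)) _) (cong suc (count-complement (f ∘ suc)))

inImage : ∀ {k n} → (Fin k → Fin n) → Fin n → Bool
inImage {zero}  p v = false
inImage {suc k} p v = does (p zero ≟ v) ∨ inImage (p ∘ suc) v

inImage-sound : ∀ {k n} (p : Fin k → Fin n) v → inImage p v ≡ true → Σ (Fin k) λ i → p i ≡ v
inImage-sound {suc k} p v im with p zero ≟ v
... | yes p₀≡v = zero , p₀≡v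
... | no _ with inImage-sound (p ∘ suc) v im
...   | i , pi≡v = suc i , pi≡v

inImage-complete : ∀ {k n} (p : Fin k → Fin n) i → inImage p (p i) ≡ true
inImage-complete {suc k} p zero with p zero ≟ p zero
... | yes _ = refl
... | no p₀≢p₀ = ⊥-elim (p₀≢p₀ refl)
inImage-complete {suc k} p (suc i) rewrite inImage-complete (p ∘ suc) i =
  ∨-zeroʳ (does (p zero ≟ p (suc i)))

count-image : ∀ {k n} (p : Fin k → Fin n) → (∀ i j → p i ≡ p j → i ≡ j) → count (inImage p) ≡ k
count-image {zero} {n} p p-inj = count-false {n}
  where
    count-false : ∀ {n} → count {n} (λ _ → false) ≡ 0
    count-false {zero}  = refl
    count-false {suc n} = count-false {n}
count-image {suc k} p p-inj =
  trans (count-remove (inImage p) (p zero) (inImage-complete p zero))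
        (cong suc (trans (count-ext _ _ removed)
                         (count-image (p ∘ suc) (λ i j → FinP.suc-injective ∘ p-inj (suc i) (suc j)))))
  where
    fresh : inImage (p ∘ suc) (p zero) ≡ false
    fresh with inImage (p ∘ suc) (p zero) in im
    ... | false = refl
    ... | true with inImage-sound (p ∘ suc) (p zero) im
    ...   | i , eq with () ← p-inj (suc i) zero eq
    removed : ∀ v → remove (inImage p) (p zero) v ≡ inImage (p ∘ suc) v
    removed v with v ≟ p zero | p zero ≟ v
    ... | yes refl  | _        rewrite fresh = ∧-zeroʳ _
    ... | no v≢p₀   | yes refl = ⊥-elim (v≢p₀ refl)
    ... | no _      | no _     = ∧-identityʳ (inImage (p ∘ suc) v)

∣tabulate∣ : ∀ {n} (f : Fin n → Bool) → ∣ tabulate f ∣ ≡ count f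
∣tabulate∣ {zero}  f = refl
∣tabulate∣ {suc n} f with f zero
... | true  = cong suc (∣tabulate∣ (f ∘ suc))
... | false = ∣tabulate∣ (f ∘ suc)

∣tabulate∩∣ : ∀ {n} (f : Fin n → Bool) (Y : Subset n) → ∣ tabulate f ∩ Y ∣ ≡ count (λ x → f x ∧ lookup Y x)
∣tabulate∩∣ {zero}  f []      = refl
∣tabulate∩∣ {suc n} f (y ∷ Y) with f zero ∧ y
... | true  = cong suc (∣tabulate∩∣ (f ∘ suc) Y)
... | false = ∣tabulate∩∣ (f ∘ suc) Y

degIn-count : ∀ {n} (a : Adjacency n) Y v → degIn a Y v ≡ count (λ x → a v x ∧ lookup Y x)
degIn-count a Y v = ∣tabulate∩∣ (a v) Y

lookup-∉ : ∀ {n} {x : Fin n} (Y : Subset n) → x ∉ Y → lookup Y x ≡ false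
lookup-∉ {x = x} Y x∉Y with lookup Y x in eq
... | true  = ⊥-elim (x∉Y (lookup⇒[]= x Y eq))
... | false = refl

degree : ∀ {n} → Adjacency n → Fin n → ℕ
degree a v = count (a v)

degIn-⊤ : ∀ {n} (a : Adjacency n) v → degIn a ⊤ v ≡ degree a v
degIn-⊤ a v = trans (degIn-count a ⊤ v)
  (count-ext _ _ (λ x → trans (cong (a v x ∧_) (lookup-replicate x true)) (∧-identityʳ (a v x))))

adj-sym : ∀ {n} (G : SimpleGraph n) u v → adj G u v ≡ true → adj G v u ≡ true
adj-sym G u v uv = trans (SimpleGraph.sym G v u) uv

adj-distinct : ∀ {n} (G : SimpleGraph n) u v → adj G u v ≡ true → u ≢ v
adj-distinct G u .u uu refl with () ← trans (≡-sym uu) (irrefl G u)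

deleteEdge-keeps : ∀ {n} (a : Adjacency n) u v x y → a x y ≡ true →
  ¬ (x ≡ u × y ≡ v) → ¬ (x ≡ v × y ≡ u) → deleteEdge a u v x y ≡ true
deleteEdge-keeps a u v x y axy ¬uv ¬vu rewrite axy with x ≟ u | y ≟ v | x ≟ v | y ≟ u
... | yes x≡u | yes y≡v | _       | _       = ⊥-elim (¬uv (x≡u , y≡v))
... | _       | _       | yes x≡v | yes y≡u = ⊥-elim (¬vu (x≡v , y≡u))
... | yes _   | no _    | yes _   | no _    = refl
... | yes _   | no _    | no _    | yes _   = refl
... | yes _   | no _    | no _    | no _    = refl
... | no _    | yes _   | yes _   | no _    = refl
... | no _    | yes _   | no _    | yes _   = refl
... | no _    | yes _   | no _    | no _    = refl
... | no _    | no _    | yes _   | no _    = refl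
... | no _    | no _    | no _    | yes _   = refl
... | no _    | no _    | no _    | no _    = refl

degree-deleteEdge-endpointˡ : ∀ {n} (a : Adjacency n) u v →
  degree a u ≤ suc (degree (deleteEdge a u v) u)
degree-deleteEdge-endpointˡ a u v = count-mono-except (a u) (deleteEdge a u v u) v
  (λ x x≢v aux → deleteEdge-keeps a u v u x aux (x≢v ∘ proj₂) (λ (u≡v , x≡u) → x≢v (trans x≡u u≡v)))

degree-deleteEdge-endpointʳ : ∀ {n} (a : Adjacency n) u v →
  degree a v ≤ suc (degree (deleteEdge a u v) v)
degree-deleteEdge-endpointʳ a u v = count-mono-except (a v) (deleteEdge a u v v) u
  (λ x x≢u avx → deleteEdge-keeps a u v v x avx (λ (v≡u , x≡v) → x≢u (trans x≡v v≡u)) (x≢u ∘ proj₂))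

degree-deleteEdge-other : ∀ {n} (a : Adjacency n) u v w → w ≢ u → w ≢ v →
  degree a w ≤ degree (deleteEdge a u v) w
degree-deleteEdge-other a u v w w≢u w≢v = count-mono (a w) (deleteEdge a u v w)
  (λ x awx → deleteEdge-keeps a u v w x awx (w≢u ∘ proj₁) (w≢v ∘ proj₁))

degree-deleteVertex : ∀ {n} (a : Adjacency n) v w →
  degree a w ≤ suc (degIn a (∁ ⁅ v ⁆) w)
degree-deleteVertex a v w = subst (λ k → degree a w ≤ suc k) (≡-sym (degIn-count a (∁ ⁅ v ⁆) w))
  (count-mono-except (a w) _ v kept)
  where
    kept : ∀ x → x ≢ v → a w x ≡ true → a w x ∧ lookup (∁ ⁅ v ⁆) x ≡ true
    kept x x≢v awx rewrite awx | lookup-map x not ⁅ v ⁆ | lookup-∉ ⁅ v ⁆ (x≢y⇒x∉⁅y⁆ x≢v) = refl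

degree-deleteVertex-nonneighbour : ∀ {n} (a : Adjacency n) v w → a w v ≡ false →
  degree a w ≤ degIn a (∁ ⁅ v ⁆) w
degree-deleteVertex-nonneighbour a v w awv = subst (degree a w ≤_) (≡-sym (degIn-count a (∁ ⁅ v ⁆) w))
  (count-mono (a w) _ kept)
  where
    kept : ∀ x → a w x ≡ true → a w x ∧ lookup (∁ ⁅ v ⁆) x ≡ true
    kept x awx with x ≟ v
    ... | yes refl with () ← trans (≡-sym awx) awv
    ... | no x≢v rewrite awx | lookup-map x not ⁅ v ⁆ | lookup-∉ ⁅ v ⁆ (x≢y⇒x∉⁅y⁆ x≢v) = refl

2≰1 : ¬ 2 ≤ 1
2≰1 (s≤s ())

module Critical₂ {n} (G : SimpleGraph n) (minDeg : HasMinDeg (adj G) ⊤ 2) (crit : Critical G 2) where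

  degree≥2 : ∀ v → 2 ≤ degree (adj G) v
  degree≥2 v = subst (2 ≤_) (degIn-⊤ (adj G) v) (proj₁ minDeg v (lookup⇒[]= v ⊤ (lookup-replicate v true)))

  edge-has-degree-two-end : ∀ u v → adj G u v ≡ true → degree (adj G) u ≡ 2 ⊎ degree (adj G) v ≡ 2
  edge-has-degree-two-end u v uv with proj₁ crit u v uv
  ... | _ , (w , _ , degw) = endpoint (w ≟ u) (w ≟ v)
    where
      deg₁ : degree (deleteEdge (adj G) u v) w ≡ 1
      deg₁ = trans (≡-sym (degIn-⊤ (deleteEdge (adj G) u v) w)) degw
      endpoint : Dec (w ≡ u) → Dec (w ≡ v) → degree (adj G) u ≡ 2 ⊎ degree (adj G) v ≡ 2
      endpoint (yes refl) _ = inj₁ (≤-antisym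
        (subst (λ k → degree (adj G) w ≤ suc k) deg₁ (degree-deleteEdge-endpointˡ (adj G) w v)) (degree≥2 w))
      endpoint (no _) (yes refl) = inj₂ (≤-antisym
        (subst (λ k → degree (adj G) w ≤ suc k) deg₁ (degree-deleteEdge-endpointʳ (adj G) u w)) (degree≥2 w))
      endpoint (no w≢u) (no w≢v) = ⊥-elim (2≰1 (≤-trans (degree≥2 w)
        (subst (degree (adj G) w ≤_) deg₁ (degree-deleteEdge-other (adj G) u v w w≢u w≢v))))

  has-degree-two-neighbour : ∀ v → Σ (Fin n) λ w → adj G v w ≡ true × degree (adj G) w ≡ 2
  has-degree-two-neighbour v with proj₂ crit v
  ... | k , k<2 , _ , (w , _ , degw) with adj G w v in wv
  ... | true  = w , adj-sym G w v wv , ≤-antisym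
        (≤-trans (degree-deleteVertex (adj G) v w) (s≤s (subst (_≤ 1) (≡-sym degw) (s≤s⁻¹ k<2))))
        (degree≥2 w)
  ... | false = ⊥-elim (2≰1 (≤-trans (degree≥2 w)
        (≤-trans (degree-deleteVertex-nonneighbour (adj G) v w wv) (subst (_≤ 1) (≡-sym degw) (s≤s⁻¹ k<2)))))

module Walks {n} (G : SimpleGraph n) (degree≥2 : ∀ v → 2 ≤ degree (adj G) v) where

  infix 4 _~_
  _~_ : Fin n → Fin n → Set
  u ~ v = adj G u v ≡ true

  Deg2 : Fin n → Set
  Deg2 v = degree (adj G) v ≡ 2

  deg2? : ∀ v → Dec (Deg2 v)
  deg2? v = degree (adj G) v ℕ.≟ 2

  ¬deg2⇒≥3 : ∀ v → ¬ Deg2 v → 3 ≤ degree (adj G) v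
  ¬deg2⇒≥3 v ¬deg2 with degree (adj G) v | degree≥2 v
  ... | suc zero          | s≤s ()
  ... | suc (suc zero)    | _ = ⊥-elim (¬deg2 refl)
  ... | suc (suc (suc _)) | _ = s≤s (s≤s (s≤s z≤n))

  degree-two-neighbours : ∀ c u w y → Deg2 c → c ~ u → c ~ w → u ≢ w → c ~ y → y ≡ u ⊎ y ≡ w
  degree-two-neighbours c u w y = exactly-two (adj G c) u w y

  -- A neighbour of c other than p.
  abstract
    successor : (p c : Fin n) → Σ (Fin n) λ y → c ~ y × y ≢ p
    successor p c = member-avoiding (adj G c) p (degree≥2 c)

  module Walk (x₀ x₁ : Fin n) (x₀~x₁ : x₀ ~ x₁) where

    -- consecutive pairs (x k , x (k + 1)) of the walk x₀ x₁ x₂ …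
    steps : ℕ → Fin n × Fin n
    steps zero    = x₀ , x₁
    steps (suc k) = proj₂ (steps k) , proj₁ (successor (proj₁ (steps k)) (proj₂ (steps k)))

    x : ℕ → Fin n
    x k = proj₁ (steps k)

    walk-adj : ∀ k → x k ~ x (suc k)
    walk-adj zero    = x₀~x₁
    walk-adj (suc k) = proj₁ (proj₂ (successor (x k) (x (suc k))))

    walk-adj⁻ : ∀ k → x (suc k) ~ x k
    walk-adj⁻ k = adj-sym G _ _ (walk-adj k)

    no-backtrack : ∀ k → x (suc (suc k)) ≢ x k
    no-backtrack k = proj₂ (proj₂ (successor (x k) (x (suc k))))

    no-loop : ∀ k → x (suc k) ≢ x k
    no-loop k eq = adj-distinct G _ _ (walk-adj k) (≡-sym eq)

    forced : ∀ k → Deg2 (x (suc k)) → ∀ y → x (suc k) ~ y → y ≡ x k ⊎ y ≡ x (suc (suc k))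
    forced k deg2 y = degree-two-neighbours (x (suc k)) (x k) (x (suc (suc k))) y deg2
      (walk-adj⁻ k) (walk-adj (suc k)) (no-backtrack k ∘ ≡-sym)

    Injective : ℕ → Set
    Injective l = ∀ i j → i ≤ l → j ≤ l → x i ≡ x j → i ≡ j

    Deg2Interior : ℕ → Set
    Deg2Interior l = ∀ i → 1 ≤ i → i < l → Deg2 (x i)

    Deg2Interior-extend : ∀ l → Deg2Interior l → Deg2 (x l) → Deg2Interior (suc l)
    Deg2Interior-extend l interior deg2 i 1≤i i<1+l with m≤n⇒m<n∨m≡n (s≤s⁻¹ i<1+l)
    ... | inj₁ i<l  = interior i 1≤i i<l
    ... | inj₂ refl = deg2

    Injective-extend : ∀ l → Injective l → (∀ i → i ≤ l → x (suc l) ≢ x i) → Injective (suc l)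
    Injective-extend l inj new i j i≤ j≤ eq with m≤n⇒m<n∨m≡n i≤ | m≤n⇒m<n∨m≡n j≤
    ... | inj₁ i<   | inj₁ j<   = inj i j (s≤s⁻¹ i<) (s≤s⁻¹ j<) eq
    ... | inj₁ i<   | inj₂ refl = ⊥-elim (new i (s≤s⁻¹ i<) (≡-sym eq))
    ... | inj₂ refl | inj₁ j<   = ⊥-elim (new j (s≤s⁻¹ j<) eq)
    ... | inj₂ refl | inj₂ refl = refl

    Injective-1 : Injective 1
    Injective-1 zero          zero          _ _ _  = refl
    Injective-1 zero          (suc zero)    _ _ eq = ⊥-elim (no-loop 0 (≡-sym eq))
    Injective-1 (suc zero)    zero          _ _ eq = ⊥-elim (no-loop 0 eq)
    Injective-1 (suc zero)    (suc zero)    _ _ _  = refl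
    Injective-1 (suc (suc _)) _ (s≤s ()) _ _
    Injective-1 _ (suc (suc _)) _ (s≤s ()) _

    Injective-bound : ∀ l → Injective l → l < n
    Injective-bound l inj = FinP.injective⇒≤ {f = x ∘ toℕ} λ {i} {j} eq →
      FinP.toℕ-injective (inj _ _ (s≤s⁻¹ (FinP.toℕ<n i)) (s≤s⁻¹ (FinP.toℕ<n j)) eq)

    first-return : ∀ l → Injective l → Deg2Interior (suc l) → ∀ i → i ≤ l → x (suc l) ≡ x i → i ≡ 0
    first-return l inj interior zero    _   eq = refl
    first-return l inj interior (suc i) i<l eq
      with forced i (interior (suc i) (s≤s z≤n) (s≤s i<l)) (x l) (subst (_~ x l) eq (walk-adj⁻ l))
    ... | inj₁ xl≡xi = ⊥-elim (<⇒≢ i<l (≡-sym (inj l i ≤-refl (<⇒≤ i<l) xl≡xi)))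
    ... | inj₂ xl≡xi+2 with m≤n⇒m<n∨m≡n i<l
    ...   | inj₂ refl = ⊥-elim (no-loop l eq)
    ...   | inj₁ i+1<l with inj l (suc (suc i)) ≤-refl i+1<l xl≡xi+2
    ...     | refl = ⊥-elim (no-backtrack (suc i) eq)

    Injective-shrink : ∀ l → Injective (suc l) → Injective l
    Injective-shrink l inj i j i≤l j≤l = inj i j (m≤n⇒m≤1+n i≤l) (m≤n⇒m≤1+n j≤l)

    Inner : ℕ → Fin n → Set
    Inner l y = Σ ℕ λ j → 1 ≤ j × j ≤ l × y ≡ x j

    stretch-neighbours : ∀ l → Deg2Interior (suc l) → ∀ i → 1 ≤ i → i ≤ l → ∀ y → x i ~ y →
      (i ≡ 1 × y ≡ x₀) ⊎ (i ≡ l × y ≡ x (suc l)) ⊎ Inner l y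
    stretch-neighbours l interior (suc i) _ i<l y xi~y
      with forced i (interior (suc i) (s≤s z≤n) (s≤s i<l)) y xi~y
    stretch-neighbours l interior (suc zero)    _ i<l y xi~y | inj₁ y≡x₀ =
      inj₁ (refl , y≡x₀)
    stretch-neighbours l interior (suc (suc i)) _ i<l y xi~y | inj₁ y≡xi =
      inj₂ (inj₂ (suc i , s≤s z≤n , <⇒≤ i<l , y≡xi))
    stretch-neighbours l interior (suc i)       _ i<l y xi~y | inj₂ y≡xi+2
      with m≤n⇒m<n∨m≡n i<l
    ... | inj₁ i+1<l = inj₂ (inj₂ (suc (suc i) , s≤s z≤n , i+1<l , y≡xi+2))
    ... | inj₂ refl  = inj₂ (inj₁ (refl , y≡xi+2))

    closing-length : ∀ l → 1 ≤ l → x (suc l) ≡ x₀ → 2 ≤ l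
    closing-length (suc zero)    _ closed = ⊥-elim (no-backtrack 0 closed)
    closing-length (suc (suc l)) _ _      = s≤s (s≤s z≤n)

    earlier? : ∀ y l → Dec (Σ ℕ λ i → i ≤ l × y ≡ x i)
    earlier? y l with FinP.any? (λ (i : Fin (suc l)) → y ≟ x (toℕ i))
    ... | yes (i , eq) = yes (toℕ i , s≤s⁻¹ (FinP.toℕ<n i) , eq)
    ... | no none = no λ (i , i≤l , eq) →
          none (fromℕ< (s≤s i≤l) , subst (λ k → y ≡ x k) (≡-sym (FinP.toℕ-fromℕ< (s≤s i≤l))) eq)

    data Outcome : Set where
      branches : ∀ l → 1 ≤ l → Injective l → Deg2Interior l → ¬ Deg2 (x l) → Outcome
      closes   : ∀ l → 1 ≤ l → Injective l → Deg2Interior (suc l) → x (suc l) ≡ x₀ → Outcome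

    explore : ∀ fuel l → n ≤ l + fuel → 1 ≤ l → Injective l → Deg2Interior l → Outcome
    explore fuel l enough 1≤l inj interior with deg2? (x l)
    ... | no ¬deg2 = branches l 1≤l inj interior ¬deg2
    ... | yes deg2 with earlier? (x (suc l)) l
    ...   | yes (i , i≤l , eq) =
            closes l 1≤l inj interior′ (subst (λ k → x (suc l) ≡ x k) (first-return l inj interior′ i i≤l eq) eq)
      where
        interior′ : Deg2Interior (suc l)
        interior′ = Deg2Interior-extend l interior deg2
    ...   | no new with fuel
    ...     | zero = ⊥-elim (<⇒≱ (Injective-bound l inj) (subst (n ≤_) (+-identityʳ l) enough))
    ...     | suc fuel′ = explore fuel′ (suc l) (subst (n ≤_) (+-suc l fuel′) enough) (m≤n⇒m≤1+n 1≤l)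
                (Injective-extend l inj (λ i i≤l eq → new (i , i≤l , eq))) (Deg2Interior-extend l interior deg2)

    outcome : Outcome
    outcome = explore n 1 (n≤1+n n) ≤-refl Injective-1 (λ { i (s≤s z≤n) (s≤s ()) })

-- A connected graph in which every vertex has degree 2 is a cycle: the walk from any
-- vertex closes up, the closed walk is stable under adjacency, so by connectivity it
-- visits every vertex exactly once.
module TwoRegular {n} (G : SimpleGraph n) (connected : Connected G)
                  (two-regular : ∀ v → degree (adj G) v ≡ 2) (v₀ : Fin n) where
  open Walks G (λ v → ≤-reflexive (≡-sym (two-regular v)))
  open Walk v₀ (proj₁ (successor v₀ v₀)) (proj₁ (proj₂ (successor v₀ v₀)))

  module Closed (L : ℕ) (1≤L : 1 ≤ L) (inj : Injective L) (closed : x (suc L) ≡ v₀) where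

    wrap : x L ~ x 0
    wrap = subst (x L ~_) closed (walk-adj L)

    neighbours : ∀ i → i ≤ L → ∀ y → x i ~ y →
      (i ≡ 0 × y ≡ x L) ⊎ (i ≡ L × y ≡ x 0) ⊎ (Σ ℕ λ j → j ≤ L × y ≡ x j × (suc j ≡ i ⊎ suc i ≡ j))
    neighbours zero _ y x₀~y with degree-two-neighbours (x 0) (x 1) (x L) y (two-regular _) (walk-adj 0) (adj-sym G _ _ wrap)
                                    (λ eq → <⇒≢ (closing-length L 1≤L closed) (inj 1 L 1≤L ≤-refl eq)) x₀~y
    ... | inj₁ y≡x₁ = inj₂ (inj₂ (1 , 1≤L , y≡x₁ , inj₂ refl))
    ... | inj₂ y≡xL = inj₁ (refl , y≡xL)
    neighbours (suc i) i<L y xi~y with forced i (two-regular _) y xi~y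
    ... | inj₁ y≡xi = inj₂ (inj₂ (i , <⇒≤ i<L , y≡xi , inj₁ refl))
    ... | inj₂ y≡xi+2 with m≤n⇒m<n∨m≡n i<L
    ...   | inj₁ i+1<L = inj₂ (inj₂ (suc (suc i) , i+1<L , y≡xi+2 , inj₂ refl))
    ...   | inj₂ refl  = inj₂ (inj₁ (refl , trans y≡xi+2 closed))

    index : ∀ v → Σ ℕ λ j → j ≤ L × v ≡ x j
    index v = follow (connected v₀ v) 0 z≤n refl
      where
        follow : ∀ {u w} → Reach G u w → ∀ i → i ≤ L → u ≡ x i → Σ ℕ λ j → j ≤ L × w ≡ x j
        follow here i i≤L u≡xi = i , i≤L , u≡xi
        follow (step {w = y} u~y rest) i i≤L refl with neighbours i i≤L y u~y
        ... | inj₁ (_ , y≡xL)                = follow rest L ≤-refl y≡xL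
        ... | inj₂ (inj₁ (_ , y≡x₀))         = follow rest 0 z≤n y≡x₀
        ... | inj₂ (inj₂ (j , j≤L , y≡xj , _)) = follow rest j j≤L y≡xj

    slot : Fin n → Fin (suc L)
    slot v = fromℕ< (s≤s (proj₁ (proj₂ (index v))))

    toℕ-slot : ∀ v → toℕ (slot v) ≡ proj₁ (index v)
    toℕ-slot v = FinP.toℕ-fromℕ< (s≤s (proj₁ (proj₂ (index v))))

    x∘slot : ∀ v → x (toℕ (slot v)) ≡ v
    x∘slot v = trans (cong x (toℕ-slot v)) (≡-sym (proj₂ (proj₂ (index v))))

    size : suc L ≡ n
    size = ≤-antisym (Injective-bound L inj) (FinP.injective⇒≤ {f = slot} λ {u} {v} eq →
      trans (≡-sym (x∘slot u)) (trans (cong (x ∘ toℕ) eq) (x∘slot v)))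

    vertex : Fin n → Fin n
    vertex i = x (toℕ i)

    position : Fin n → Fin n
    position v = cast size (slot v)

    toℕ≤L : (i : Fin n) → toℕ i ≤ L
    toℕ≤L i = s≤s⁻¹ (subst (toℕ i <_) (≡-sym size) (FinP.toℕ<n i))

    toℕ-position : ∀ v → toℕ (position v) ≡ toℕ (slot v)
    toℕ-position v = FinP.toℕ-cast size (slot v)

    vertex∘position : ∀ v → vertex (position v) ≡ v
    vertex∘position v = trans (cong x (toℕ-position v)) (x∘slot v)

    position∘vertex : ∀ i → position (vertex i) ≡ i
    position∘vertex i = FinP.toℕ-injective (begin
      toℕ (position (vertex i))  ≡⟨ toℕ-position (vertex i) ⟩
      toℕ (slot (vertex i))      ≡⟨ toℕ-slot (vertex i) ⟩
      proj₁ (index (vertex i))   ≡⟨ inj _ _ (proj₁ (proj₂ (index (vertex i)))) (toℕ≤L i)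
                                            (≡-sym (proj₂ (proj₂ (index (vertex i))))) ⟩
      toℕ i                      ∎)
      where open ≡-Reasoning

    σ : Permutation′ n
    σ = permutation vertex position vertex∘position position∘vertex

    last : (i : Fin n) → toℕ i ≡ L → suc (toℕ i) ≡ n
    last i i≡L = trans (cong suc i≡L) size

    last⁻ : (i : Fin n) → suc (toℕ i) ≡ n → toℕ i ≡ L
    last⁻ i eq = suc-injective (trans eq (≡-sym size))

    adjacent⇒cycleAdj : ∀ i j → adj G (vertex i) (vertex j) ≡ true → CycleAdj n i j
    adjacent⇒cycleAdj i j adj-ij with neighbours (toℕ i) (toℕ≤L i) (vertex j) adj-ij
    ... | inj₁ (i≡0 , xj≡xL) = inj₂ (inj₂ (inj₁ (i≡0 , last j (inj _ _ (toℕ≤L j) ≤-refl xj≡xL))))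
    ... | inj₂ (inj₁ (i≡L , xj≡x₀)) = inj₂ (inj₂ (inj₂ (inj _ _ (toℕ≤L j) z≤n xj≡x₀ , last i i≡L)))
    ... | inj₂ (inj₂ (k , k≤L , xj≡xk , inj₁ k+1≡i)) =
          inj₂ (inj₁ (subst (λ m → suc m ≡ toℕ i) (≡-sym (inj _ _ (toℕ≤L j) k≤L xj≡xk)) k+1≡i))
    ... | inj₂ (inj₂ (k , k≤L , xj≡xk , inj₂ i+1≡k)) =
          inj₁ (trans i+1≡k (≡-sym (inj _ _ (toℕ≤L j) k≤L xj≡xk)))

    cycleAdj⇒adjacent : ∀ i j → CycleAdj n i j → adj G (vertex i) (vertex j) ≡ true
    cycleAdj⇒adjacent i j (inj₁ i+1≡j) = subst (λ k → vertex i ~ x k) i+1≡j (walk-adj (toℕ i))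
    cycleAdj⇒adjacent i j (inj₂ (inj₁ j+1≡i)) = adj-sym G _ _ (subst (λ k → vertex j ~ x k) j+1≡i (walk-adj (toℕ j)))
    cycleAdj⇒adjacent i j (inj₂ (inj₂ (inj₁ (i≡0 , j+1≡n)))) =
      subst₂ (λ p q → x p ~ x q) (≡-sym i≡0) (≡-sym (last⁻ j j+1≡n)) (adj-sym G _ _ wrap)
    cycleAdj⇒adjacent i j (inj₂ (inj₂ (inj₂ (j≡0 , i+1≡n)))) =
      subst₂ (λ p q → x p ~ x q) (≡-sym (last⁻ i i+1≡n)) (≡-sym j≡0) wrap

    is-cycle : IsCycle G
    is-cycle = subst (3 ≤_) size (s≤s (closing-length L 1≤L closed)) , σ ,
               λ i j → adjacent⇒cycleAdj i j , cycleAdj⇒adjacent i j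

  is-cycle : IsCycle G
  is-cycle with outcome
  ... | branches _ _ _ _ ¬deg2      = ⊥-elim (¬deg2 (two-regular _))
  ... | closes L 1≤L inj _ closed = Closed.is-cycle L 1≤L inj closed

PathDecomposition : ∀ {n} → SimpleGraph n → Set
PathDecomposition {n} G =
  Σ (Subset n) λ Y₁ → let Y₂ = ∁ Y₁ in
  Σ ℕ λ m → Σ (Fin (suc (suc m)) → Fin n) λ p →
    let a = p zero
        b = p (fromℕ (suc m))
    in ∣ Y₁ ∣ ≡ suc (suc m)
       × suc (suc m) + 3 ≤ n
       × InducedPath G Y₁ (suc (suc m)) p
       × HasMinDeg (adj G) Y₂ 2
       × (Σ (Fin n) λ a′ → Σ (Fin n) λ b′ →
            a′ ∈ Y₂ × adj G a a′ ≡ true × (∀ y → y ∈ Y₂ → adj G a y ≡ true → y ≡ a′)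
            × b′ ∈ Y₂ × adj G b b′ ≡ true × (∀ y → y ∈ Y₂ → adj G b y ≡ true → y ≡ b′)
            × (a′ ≡ b′ ⊎ adj G a′ b′ ≡ false))
       × (∀ x y → x ∈ Y₁ → y ∈ Y₂ → adj G x y ≡ true → x ≡ a ⊎ x ≡ b)

-- Let h be a vertex of degree ≠ 2 and
-- h = x₀, x₁, …, x_L, x_(L+1) = b a walk with L ≥ 2, x₀, …, x_L distinct,
-- x₁, …, x_L of degree 2 and b of degree ≠ 2.  If b ≠ h, or h has degree ≥ 4, then Y₁ = {x₁, …, x_L} works:
-- only x₁ and x_L see Y₂, namely h and b, and criticality makes h of degree ≥ 3 have
-- a neighbour of degree 2 in Y₂, which keeps G[Y₂] of minimum degree exactly 2.
module HangingPath {n} (G : SimpleGraph n) (minDeg : HasMinDeg (adj G) ⊤ 2) (crit : Critical G 2)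
                   (h d : Fin n) (h~d : adj G h d ≡ true) (m : ℕ) where
  open Critical₂ G minDeg crit
  open Walks G degree≥2
  open Walk h d h~d

  L : ℕ
  L = suc (suc m)

  b : Fin n
  b = x (suc L)

  path : Fin L → Fin n
  path i = x (suc (toℕ i))

  path-last : path (fromℕ (suc m)) ≡ x L
  path-last = cong (λ k → x (suc k)) (FinP.toℕ-fromℕ (suc m))

  onPath : Fin n → Bool
  onPath = inImage path

  Y₁ : Subset n
  Y₁ = tabulate onPath

  OnPath : Fin n → Set
  OnPath = Inner L

  onPath-sound : ∀ y → onPath y ≡ true → OnPath y
  onPath-sound y on with inImage-sound path y on
  ... | i , refl = suc (toℕ i) , s≤s z≤n , FinP.toℕ<n i , refl

  onPath-complete : ∀ y → OnPath y → onPath y ≡ true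
  onPath-complete y (suc j , _ , j≤L , refl) =
    subst (λ k → onPath (x (suc k)) ≡ true) (FinP.toℕ-fromℕ< j≤L) (inImage-complete path (fromℕ< j≤L))

  ∈Y₁⇒ : ∀ y → y ∈ Y₁ → OnPath y
  ∈Y₁⇒ y y∈Y₁ = onPath-sound y (trans (≡-sym (lookup∘tabulate onPath y)) ([]=⇒lookup y∈Y₁))

  ⇒∈Y₁ : ∀ y → OnPath y → y ∈ Y₁
  ⇒∈Y₁ y on = lookup⇒[]= y Y₁ (trans (lookup∘tabulate onPath y) (onPath-complete y on))

  lookup-Y₂ : ∀ y → lookup (∁ Y₁) y ≡ not (onPath y)
  lookup-Y₂ y = trans (lookup-map y not Y₁) (cong not (lookup∘tabulate onPath y))

  ∈Y₂⇒ : ∀ y → y ∈ ∁ Y₁ → ¬ OnPath y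
  ∈Y₂⇒ y y∈Y₂ on with () ← trans (≡-sym ([]=⇒lookup y∈Y₂)) (trans (lookup-Y₂ y) (cong not (onPath-complete y on)))

  onPath-false : ∀ y → ¬ OnPath y → onPath y ≡ false
  onPath-false y off with onPath y in on
  ... | true  = ⊥-elim (off (onPath-sound y on))
  ... | false = refl

  ⇒∈Y₂ : ∀ y → ¬ OnPath y → y ∈ ∁ Y₁
  ⇒∈Y₂ y off = lookup⇒[]= y (∁ Y₁) (trans (lookup-Y₂ y) (cong not (onPath-false y off)))

  degOff : Fin n → ℕ
  degOff v = count (λ y → adj G v y ∧ not (onPath y))

  degY₂ : ∀ v → degIn (adj G) (∁ Y₁) v ≡ degOff v
  degY₂ v = trans (degIn-count (adj G) (∁ Y₁) v) (count-ext _ _ (λ y → cong (adj G v y ∧_) (lookup-Y₂ y)))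

  degOff≤degree : ∀ v → degOff v ≤ degree (adj G) v
  degOff≤degree v = count-mono _ (adj G v) (λ y → proj₁ ∘ ∧-true⁻)

  off-neighbour : ∀ v y → v ~ y → ¬ OnPath y → adj G v y ∧ not (onPath y) ≡ true
  off-neighbour v y v~y off rewrite v~y | onPath-false y off = refl

  module _ (¬deg2-h : ¬ Deg2 h) (interior : Deg2Interior (suc L)) (inj : Injective L) (¬deg2-b : ¬ Deg2 b) where

    h-off : ¬ OnPath h
    h-off (j , 1≤j , j≤L , h≡xj) = ¬deg2-h (subst Deg2 (≡-sym h≡xj) (interior j 1≤j (s≤s j≤L)))

    b-off : ¬ OnPath b
    b-off (j , 1≤j , j≤L , b≡xj) = ¬deg2-b (subst Deg2 (≡-sym b≡xj) (interior j 1≤j (s≤s j≤L)))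

    path-neighbours : ∀ i → 1 ≤ i → i ≤ L → ∀ y → x i ~ y → (i ≡ 1 × y ≡ h) ⊎ (i ≡ L × y ≡ b) ⊎ OnPath y
    path-neighbours = stretch-neighbours L interior

    attachments : ∀ v y → ¬ OnPath v → OnPath y → v ~ y → (y ≡ x 1 × v ≡ h) ⊎ (y ≡ x L × v ≡ b)
    attachments v y v-off (j , 1≤j , j≤L , refl) v~y with path-neighbours j 1≤j j≤L v (adj-sym G _ _ v~y)
    ... | inj₁ (refl , v≡h)       = inj₁ (refl , v≡h)
    ... | inj₂ (inj₁ (refl , v≡b)) = inj₂ (refl , v≡b)
    ... | inj₂ (inj₂ v-on)        = ⊥-elim (v-off v-on)

    stays-off : ∀ v y → ¬ OnPath v → v ~ y → (y ≡ x 1 → v ≡ h → ⊥) → (y ≡ x L → v ≡ b → ⊥) →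
      adj G v y ∧ not (onPath y) ≡ true
    stays-off v y v-off v~y not-first not-last = off-neighbour v y v~y λ y-on →
      [ uncurry not-first , uncurry not-last ] (attachments v y v-off y-on v~y)

    path-injective : ∀ i j → path i ≡ path j → i ≡ j
    path-injective i j eq = FinP.toℕ-injective (suc-injective (inj _ _ (FinP.toℕ<n i) (FinP.toℕ<n j) eq))

    ∣Y₁∣ : ∣ Y₁ ∣ ≡ L
    ∣Y₁∣ = trans (∣tabulate∣ onPath) (count-image path path-injective)

    path-adj⇒ : ∀ i j → path i ~ path j → PathAdj L i j
    path-adj⇒ i j adj-ij with forced (toℕ i) (interior _ (s≤s z≤n) (s≤s (FinP.toℕ<n i))) (path j) adj-ij
    ... | inj₁ xj≡xi = inj₂ (inj _ _ (FinP.toℕ<n j) (<⇒≤ (FinP.toℕ<n i)) xj≡xi)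
    ... | inj₂ xj≡xi+2 with m≤n⇒m<n∨m≡n (FinP.toℕ<n i)
    ...   | inj₁ i+1<L = inj₁ (≡-sym (suc-injective (inj _ _ (FinP.toℕ<n j) i+1<L xj≡xi+2)))
    ...   | inj₂ i+1≡L = ⊥-elim (b-off (suc (toℕ j) , s≤s z≤n , FinP.toℕ<n j ,
                         trans (cong (λ k → x (suc k)) (≡-sym i+1≡L)) (≡-sym xj≡xi+2)))

    PathAdj⇒ : ∀ i j → PathAdj L i j → path i ~ path j
    PathAdj⇒ i j (inj₁ i+1≡j) = subst (λ k → path i ~ x (suc k)) i+1≡j (walk-adj (suc (toℕ i)))
    PathAdj⇒ i j (inj₂ j+1≡i) = subst (λ k → x (suc k) ~ path j) j+1≡i (walk-adj⁻ (suc (toℕ j)))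

    induced : InducedPath G Y₁ L path
    induced = path-injective
            , (λ y → (λ y∈Y₁ → inImage-sound path y (onPath-complete y (∈Y₁⇒ y y∈Y₁)))
                   , (λ (i , path-i≡y) → ⇒∈Y₁ y (suc (toℕ i) , s≤s z≤n , FinP.toℕ<n i , ≡-sym path-i≡y)))
            , (λ i j → path-adj⇒ i j , PathAdj⇒ i j)

    first-end : ∀ y → y ∈ ∁ Y₁ → x 1 ~ y → y ≡ h
    first-end y y∈Y₂ x₁~y with path-neighbours 1 (s≤s z≤n) (s≤s z≤n) y x₁~y
    ... | inj₁ (_ , y≡h)      = y≡h
    ... | inj₂ (inj₁ (() , _))
    ... | inj₂ (inj₂ y-on)    = ⊥-elim (∈Y₂⇒ y y∈Y₂ y-on)

    last-end : ∀ y → y ∈ ∁ Y₁ → path (fromℕ (suc m)) ~ y → y ≡ b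
    last-end y y∈Y₂ xL~y with path-neighbours L (s≤s z≤n) ≤-refl y (subst (_~ y) path-last xL~y)
    ... | inj₁ (() , _)
    ... | inj₂ (inj₁ (_ , y≡b)) = y≡b
    ... | inj₂ (inj₂ y-on)      = ⊥-elim (∈Y₂⇒ y y∈Y₂ y-on)

    only-ends : ∀ u y → u ∈ Y₁ → y ∈ ∁ Y₁ → u ~ y → u ≡ x 1 ⊎ u ≡ path (fromℕ (suc m))
    only-ends u y u∈Y₁ y∈Y₂ u~y with attachments y u (∈Y₂⇒ y y∈Y₂) (∈Y₁⇒ u u∈Y₁) (adj-sym G _ _ u~y)
    ... | inj₁ (u≡x₁ , _) = inj₁ u≡x₁
    ... | inj₂ (u≡xL , _) = inj₂ (trans u≡xL (≡-sym path-last))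

    -- by criticality, h and b are equal or non-adjacent: both have degree ≠ 2
    h-b : h ≡ b ⊎ adj G h b ≡ false
    h-b with adj G h b in h~b
    ... | false = inj₂ refl
    ... | true with edge-has-degree-two-end h b h~b
    ...   | inj₁ deg2-h = ⊥-elim (¬deg2-h deg2-h)
    ...   | inj₂ deg2-b = ⊥-elim (¬deg2-b deg2-b)

    -- With a spare edge at h (b ≠ h, or h of degree ≥ 4), every vertex of Y₂ keeps
    -- two neighbours in Y₂, and h has a neighbour w in Y₂, of degree exactly 2 there.
    module _ (spare : b ≢ h ⊎ 4 ≤ degree (adj G) h) where

      Y₂-degree≥2 : ∀ v → v ∈ ∁ Y₁ → 2 ≤ degIn (adj G) (∁ Y₁) v
      Y₂-degree≥2 v v∈Y₂ = subst (2 ≤_) (≡-sym (degY₂ v)) (by-cases (v ≟ h) (v ≟ b) spare)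
        where
          v-off : ¬ OnPath v
          v-off = ∈Y₂⇒ v v∈Y₂
          -- h loses only x₁ (and x_L if b = h), b loses only x_L, the others lose nothing
          by-cases : Dec (v ≡ h) → Dec (v ≡ b) → b ≢ h ⊎ 4 ≤ degree (adj G) h → 2 ≤ degOff v
          by-cases (yes refl) _ (inj₁ b≢h) = s≤s⁻¹ (≤-trans (¬deg2⇒≥3 v ¬deg2-h)
            (count-mono-except _ _ (x 1) λ y y≢x₁ v~y →
              stays-off v y v-off v~y (λ y≡x₁ _ → y≢x₁ y≡x₁) (λ _ h≡b → b≢h (≡-sym h≡b))))
          by-cases (yes refl) _ (inj₂ four) = s≤s⁻¹ (s≤s⁻¹ (≤-trans four
            (count-mono-except₂ _ _ (x 1) (x L) λ y y≢x₁ y≢xL v~y →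
              stays-off v y v-off v~y (λ y≡x₁ _ → y≢x₁ y≡x₁) (λ y≡xL _ → y≢xL y≡xL))))
          by-cases (no v≢h) (yes refl) _ = s≤s⁻¹ (≤-trans (¬deg2⇒≥3 v ¬deg2-b)
            (count-mono-except _ _ (x L) λ y y≢xL v~y →
              stays-off v y v-off v~y (λ _ → v≢h) (λ y≡xL _ → y≢xL y≡xL)))
          by-cases (no v≢h) (no v≢b) _ = ≤-trans (degree≥2 v)
            (count-mono _ _ λ y v~y → stays-off v y v-off v~y (λ _ → v≢h) (λ _ → v≢b))

      spare-neighbour : Σ (Fin n) λ w → h ~ w × ¬ OnPath w
      spare-neighbour = from spare
        where
          from : b ≢ h ⊎ 4 ≤ degree (adj G) h → Σ (Fin n) λ w → h ~ w × ¬ OnPath w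
          from (inj₁ b≢h) with member-avoiding (adj G h) (x 1) (degree≥2 h)
          ... | w , h~w , w≢x₁ = w , h~w , λ w-on →
                [ (λ (w≡x₁ , _) → w≢x₁ w≡x₁) , (λ (_ , h≡b) → b≢h (≡-sym h≡b)) ]
                  (attachments h w h-off w-on h~w)
          from (inj₂ four) with member-avoiding₂ (adj G h) (x 1) (x L) (≤-trans (s≤s (s≤s (s≤s z≤n))) four)
          ... | w , h~w , w≢x₁ , w≢xL = w , h~w , λ w-on →
                [ (λ (w≡x₁ , _) → w≢x₁ w≡x₁) , (λ (w≡xL , _) → w≢xL w≡xL) ]
                  (attachments h w h-off w-on h~w)

      w : Fin n
      w = proj₁ spare-neighbour

      h~w : h ~ w
      h~w = proj₁ (proj₂ spare-neighbour)

      w-off : ¬ OnPath w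
      w-off = proj₂ (proj₂ spare-neighbour)

      -- by criticality the edge hw has an end of degree 2, which is not h
      deg2-w : Deg2 w
      deg2-w with edge-has-degree-two-end h w h~w
      ... | inj₁ deg2-h = ⊥-elim (¬deg2-h deg2-h)
      ... | inj₂ deg2-w = deg2-w

      w-neighbours-off : ∀ y → w ~ y → adj G w y ∧ not (onPath y) ≡ true
      w-neighbours-off y w~y = stays-off w y w-off w~y (λ _ w≡h → adj-distinct G h w h~w (≡-sym w≡h))
                                 (λ _ w≡b → ¬deg2-b (subst Deg2 w≡b deg2-w))

      w-degY₂ : degIn (adj G) (∁ Y₁) w ≡ 2
      w-degY₂ = trans (degY₂ w) (≤-antisym
        (≤-trans (degOff≤degree w) (≤-reflexive deg2-w))
        (subst (_≤ degOff w) deg2-w (count-mono (adj G w) _ w-neighbours-off)))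

      -- h, w and the other neighbour of w lie outside the path
      Y₂-size≥3 : 3 ≤ count (not ∘ onPath)
      Y₂-size≥3 with member-avoiding (adj G w) h (degree≥2 w)
      ... | w₂ , w~w₂ , w₂≢h = three-members (not ∘ onPath) h w w₂
            (cong not (onPath-false h h-off)) (cong not (onPath-false w w-off))
            (proj₂ (∧-true⁻ (w-neighbours-off w₂ w~w₂)))
            (adj-distinct G h w h~w) (w₂≢h ∘ ≡-sym) (adj-distinct G w w₂ w~w₂)

      -- |Y₁| = L and |Y₂| ≥ 3 give L + 3 ≤ n
      size : L + 3 ≤ n
      size = subst (L + 3 ≤_) (trans (cong (_+ count (not ∘ onPath)) (≡-sym (count-image path path-injective)))
                                     (count-complement onPath))
                   (+-monoʳ-≤ L Y₂-size≥3)

      decomposition : PathDecomposition G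
      decomposition = Y₁ , m , path , ∣Y₁∣ , size , induced
                    , (Y₂-degree≥2 , w , ⇒∈Y₂ w w-off , w-degY₂)
                    , (h , b , ⇒∈Y₂ h h-off , walk-adj⁻ 0 , first-end
                         , ⇒∈Y₂ b b-off , subst (_~ b) (≡-sym path-last) (walk-adj L) , last-end , h-b)
                    , only-ends

module Branching {n} (G : SimpleGraph n) (minDeg : HasMinDeg (adj G) ⊤ 2) (crit : Critical G 2) where
  open Critical₂ G minDeg crit
  open Walks G degree≥2

  record Loop (h d : Fin n) (h~d : h ~ d) : Set where
    open Walk h d h~d
    field
      length    : ℕ
      long      : 2 ≤ length
      interior  : Deg2Interior (suc length)
      injective : Injective length
      closed    : x (suc length) ≡ h

  -- Leaving h along any edge either yields the decomposition or a loop at h, and the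
  -- latter only when h has degree 3: a walk ending after one step would join two
  -- vertices of degree ≠ 2, after two steps its middle vertex would violate vertex
  -- criticality, and otherwise the walk is a hanging path.
  module Leaving (h d : Fin n) (h~d : h ~ d) (¬deg2-h : ¬ Deg2 h) where
    open Walk h d h~d

    leave : PathDecomposition G ⊎ (degree (adj G) h ≡ 3 × Loop h d h~d)
    leave with outcome
    ... | branches zero () _ _ _
    ... | branches (suc zero) _ _ _ ¬deg2-x₁ with edge-has-degree-two-end h (x 1) h~d
    ...   | inj₁ deg2-h  = ⊥-elim (¬deg2-h deg2-h)
    ...   | inj₂ deg2-x₁ = ⊥-elim (¬deg2-x₁ deg2-x₁)
    leave | branches (suc (suc zero)) _ _ interior ¬deg2-x₂ with has-degree-two-neighbour (x 1)
    ...   | v , x₁~v , deg2-v with forced 0 (interior 1 (s≤s z≤n) (s≤s (s≤s z≤n))) v x₁~v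
    ...     | inj₁ v≡h  = ⊥-elim (¬deg2-h (subst Deg2 v≡h deg2-v))
    ...     | inj₂ v≡x₂ = ⊥-elim (¬deg2-x₂ (subst Deg2 v≡x₂ deg2-v))
    leave | branches (suc (suc (suc m))) _ inj interior ¬deg2-b =
      inj₁ (HangingPath.decomposition G minDeg crit h d h~d m ¬deg2-h interior
              (Injective-shrink _ inj) ¬deg2-b (inj₁ b≢h))
      where
        b≢h : x (suc (suc (suc m))) ≢ h
        b≢h b≡h with inj _ 0 ≤-refl z≤n b≡h
        ... | ()
    leave | closes zero () _ _ _
    leave | closes (suc zero) 1≤l _ _ closed = ⊥-elim (2≰1 (closing-length 1 1≤l closed))
    leave | closes (suc (suc m)) _ inj interior closed with 4 ℕ.≤? degree (adj G) h
    ... | yes four = inj₁ (HangingPath.decomposition G minDeg crit h d h~d m ¬deg2-h interior inj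
                             (¬deg2-h ∘ subst Deg2 closed) (inj₂ four))
    ... | no ¬four = inj₂ (≤-antisym (s≤s⁻¹ (≰⇒> ¬four)) (¬deg2⇒≥3 h ¬deg2-h) ,
                           record { length = suc (suc m) ; long = s≤s (s≤s z≤n) ; interior = interior
                                  ; injective = inj ; closed = closed })

  -- At a vertex h of degree 3 there are no two loops leaving along different edges.
  -- The first loop P uses the neighbours x₁ and x_k of h, so the second, Q, leaves
  -- along the third neighbour e and returns to h through x₁ or x_k.  Walked
  -- backwards, Q never leaves P, so e would lie on P and be x₁ or x_k after all.
  module TwoLoops (h : Fin n) (deg3 : degree (adj G) h ≡ 3) (¬deg2-h : ¬ Deg2 h) (d e : Fin n)
                  (h~d : h ~ d) (h~e : h ~ e) (first : Loop h d h~d) (second : Loop h e h~e) where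
    module P = Walk h d h~d
    module Q = Walk h e h~e
    open Loop first using ()
      renaming (length to k; long to 2≤k; interior to P-interior; injective to P-inj; closed to P-closed)
    open Loop second using ()
      renaming (length to l; long to 2≤l; injective to Q-inj; closed to Q-closed)

    module _ (e≢x₁ : e ≢ P.x 1) (e≢xk : e ≢ P.x k) where

      OnP : Fin n → Set
      OnP = P.Inner k

      h-off-P : ¬ OnP h
      h-off-P (i , 1≤i , i≤k , h≡xi) = ¬deg2-h (subst Deg2 (≡-sym h≡xi) (P-interior i 1≤i (s≤s i≤k)))

      -- Q re-enters h from one of the three neighbours x₁, x_k, e of h, and not from e = Q.x 1.
      Q-last-on-P : OnP (Q.x l)
      Q-last-on-P
        with exactly-three (adj G h) (P.x 1) (P.x k) e (Q.x l) deg3 h~d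
               (subst (_~ P.x k) P-closed (P.walk-adj⁻ k)) h~e
               (λ eq → <⇒≢ 2≤k (P-inj 1 k (≤-trans (s≤s z≤n) 2≤k) ≤-refl eq)) (e≢x₁ ∘ ≡-sym) (e≢xk ∘ ≡-sym)
               (subst (_~ Q.x l) Q-closed (Q.walk-adj⁻ l))
      ... | inj₁ ql≡x₁        = 1 , s≤s z≤n , ≤-trans (s≤s z≤n) 2≤k , ql≡x₁
      ... | inj₂ (inj₁ ql≡xk) = k , ≤-trans (s≤s z≤n) 2≤k , ≤-refl , ql≡xk
      ... | inj₂ (inj₂ ql≡e)  = ⊥-elim (<⇒≢ 2≤l (≡-sym (Q-inj l 1 ≤-refl (≤-trans (s≤s z≤n) 2≤l) ql≡e)))

      Q-avoids-h : ∀ j → 1 ≤ j → j ≤ l → Q.x j ≢ h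
      Q-avoids-h j 1≤j j≤l qj≡h with Q-inj j 0 j≤l z≤n qj≡h
      Q-avoids-h j () j≤l qj≡h | refl

      -- an inner vertex of P sees only h and P, so stepping back along Q stays on P
      backwards : ∀ j → 1 ≤ j → j ≤ l → OnP (Q.x (suc j)) → OnP (Q.x j)
      backwards j 1≤j j≤l (i , 1≤i , i≤k , eq)
        with P.stretch-neighbours k P-interior i 1≤i i≤k (Q.x j) (subst (_~ Q.x j) eq (Q.walk-adj⁻ j))
      ... | inj₁ (_ , qj≡h)           = ⊥-elim (Q-avoids-h j 1≤j j≤l qj≡h)
      ... | inj₂ (inj₁ (_ , qj≡xk+1)) = ⊥-elim (Q-avoids-h j 1≤j j≤l (trans qj≡xk+1 P-closed))
      ... | inj₂ (inj₂ qj-on)         = qj-on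

      descend : ∀ r j → j + r ≡ l → 1 ≤ j → OnP (Q.x j)
      descend zero    j j≡l     _   = subst (OnP ∘ Q.x) (trans (≡-sym j≡l) (+-identityʳ j)) Q-last-on-P
      descend (suc r) j j+r+1≡l 1≤j = backwards j 1≤j (subst (j ≤_) j+r+1≡l (m≤m+n j (suc r)))
        (descend r (suc j) (trans (≡-sym (+-suc j r)) j+r+1≡l) (s≤s z≤n))

      -- in particular e = Q.x 1, a neighbour of h on P, is x₁ or x_k
      impossible : ⊥
      impossible with descend (l ∸ 1) 1 (m+[n∸m]≡n (≤-trans (s≤s z≤n) 2≤l)) (s≤s z≤n)
      ... | i , 1≤i , i≤k , e≡xi
        with P.stretch-neighbours k P-interior i 1≤i i≤k h (subst (_~ h) e≡xi (adj-sym G _ _ h~e))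
      ...   | inj₁ (refl , _)        = e≢x₁ e≡xi
      ...   | inj₂ (inj₁ (refl , _)) = e≢xk e≡xi
      ...   | inj₂ (inj₂ h-on)       = h-off-P h-on

  -- Every vertex of degree ≠ 2 yields the decomposition: leave it along some edge,
  -- and if that returns as a loop at h of degree 3, along the third edge of h.
  decomposition-at : ∀ h → ¬ Deg2 h → PathDecomposition G
  decomposition-at h ¬deg2-h = from-first (Leaving.leave h d h~d ¬deg2-h)
    where
      d : Fin n
      d = proj₁ (successor h h)
      h~d : h ~ d
      h~d = proj₁ (proj₂ (successor h h))
      open Walk h d h~d using (x)

      from-first : PathDecomposition G ⊎ (degree (adj G) h ≡ 3 × Loop h d h~d) → PathDecomposition G
      from-first (inj₁ decomposition) = decomposition
      from-first (inj₂ (deg3 , first))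
        with member-avoiding₂ (adj G h) (x 1) (x (Loop.length first)) (¬deg2⇒≥3 h ¬deg2-h)
      ... | e , h~e , e≢x₁ , e≢xk with Leaving.leave h e h~e ¬deg2-h
      ...   | inj₁ decomposition = decomposition
      ...   | inj₂ (_ , second)  =
              ⊥-elim (TwoLoops.impossible h deg3 ¬deg2-h d e h~d h~e first second e≢x₁ e≢xk)

lemma3p2 : ∀ {n} (G : SimpleGraph n) → Connected G → HasMinDeg (adj G) ⊤ 2 → Critical G 2 →
  IsCycle G
  ⊎ (Σ (Subset n) λ Y₁ → let Y₂ = ∁ Y₁ in
     Σ ℕ λ m → Σ (Fin (suc (suc m)) → Fin n) λ p →
       let a = p zero
           b = p (fromℕ (suc m))
       in ∣ Y₁ ∣ ≡ suc (suc m)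
          × suc (suc m) + 3 ≤ n
          × InducedPath G Y₁ (suc (suc m)) p
          × HasMinDeg (adj G) Y₂ 2
          × (Σ (Fin n) λ a′ → Σ (Fin n) λ b′ →
               a′ ∈ Y₂ × adj G a a′ ≡ true × (∀ y → y ∈ Y₂ → adj G a y ≡ true → y ≡ a′)
               × b′ ∈ Y₂ × adj G b b′ ≡ true × (∀ y → y ∈ Y₂ → adj G b y ≡ true → y ≡ b′)
               × (a′ ≡ b′ ⊎ adj G a′ b′ ≡ false))
          × (∀ x y → x ∈ Y₁ → y ∈ Y₂ → adj G x y ≡ true → x ≡ a ⊎ x ≡ b))
lemma3p2 {n} G connected minDeg crit with FinP.all? (λ v → degree (adj G) v ℕ.≟ 2)
... | yes two-regular = inj₁ (TwoRegular.is-cycle G connected two-regular (proj₁ (proj₂ minDeg)))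
... | no ¬two-regular with FinP.¬∀⟶∃¬ n _ (λ v → degree (adj G) v ℕ.≟ 2) ¬two-regular
...   | h , ¬deg2-h = inj₂ (Branching.decomposition-at G minDeg crit h ¬deg2-h)
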